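{- Let $R$ be a $q$-torsion free commutative ring ($q\in R$), let $n\geq 1$, and let $f_1,f_2\in\mathrm{Aut}(\mathbb{A}^1_{R/q^n})$. Suppose $r,s\geq 0$ are integers with $r+s\geq n$, $f_1(T)\equiv T\bmod q^r$ and $f_2(T)\equiv T\bmod q^s$. Then $f_1\circ f_2\equiv f_2\circ f_1 \bmod q^n$.
   Context: For a commutative ring $B$, $\mathrm{Aut}(\mathbb{A}^1_B)$ denotes the group of polynomials $f\in B[T]$ invertible under composition, with group law composition. -}

module Defs where

open import Level using (_⊔_)
open import Algebra.Bundles using (CommutativeRing)
open import Data.Nat using (ℕ; zero; suc)
open import Data.List using (List; []; _∷_; map)
open import Data.Product using (Σ; _×_)

-- Polynomials over a commutative ring R, as coefficient lists (lowest degree first).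
-- A polynomial over R/q^n is represented by a lift in R[T]; all relations below
-- are invariant under changing the lift.
module Poly {c ℓ} (R : CommutativeRing c ℓ) where
  open CommutativeRing R

  Pol : Set c
  Pol = List Carrier

  pow : Carrier → ℕ → Carrier
  pow x zero = 1#
  pow x (suc k) = x * pow x k

  coeff : Pol → ℕ → Carrier
  coeff [] i = 0#
  coeff (a ∷ f) zero = a
  coeff (a ∷ f) (suc i) = coeff f i

  infixl 6 _⊕_
  _⊕_ : Pol → Pol → Pol
  [] ⊕ g = g
  (a ∷ f) ⊕ [] = a ∷ f
  (a ∷ f) ⊕ (b ∷ g) = (a + b) ∷ (f ⊕ g)

  scale : Carrier → Pol → Pol
  scale a g = map (a *_) g

  infixl 7 _⊗_
  _⊗_ : Pol → Pol → Pol
  [] ⊗ g = []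
  (a ∷ f) ⊗ g = scale a g ⊕ (0# ∷ (f ⊗ g))

  infixr 9 _∘ₚ_
  _∘ₚ_ : Pol → Pol → Pol
  [] ∘ₚ g = []
  (a ∷ f) ∘ₚ g = (a ∷ []) ⊕ (g ⊗ (f ∘ₚ g))

  X : Pol
  X = 0# ∷ 1# ∷ []

  TorsionFree : Carrier → Set (c ⊔ ℓ)
  TorsionFree q = ∀ x → q * x ≈ 0# → x ≈ 0#

  ModQ : Carrier → ℕ → Carrier → Carrier → Set (c ⊔ ℓ)
  ModQ q n a b = Σ Carrier λ d → a - b ≈ pow q n * d

  -- images a,b of R/q^n are congruent modulo the ideal (q^r) of R/q^n,
  -- i.e. a - b ∈ (q^r, q^n) in R
  ModQIn : Carrier → ℕ → ℕ → Carrier → Carrier → Set (c ⊔ ℓ)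
  ModQIn q n r a b = Σ Carrier λ e → Σ Carrier λ d → a - b ≈ pow q r * e + pow q n * d

  PolyRel : (Carrier → Carrier → Set (c ⊔ ℓ)) → Pol → Pol → Set (c ⊔ ℓ)
  PolyRel P f g = ∀ i → P (coeff f i) (coeff g i)

  IsAut : Carrier → ℕ → Pol → Set (c ⊔ ℓ)
  IsAut q n f = Σ Pol λ g → PolyRel (ModQ q n) (f ∘ₚ g) X × PolyRel (ModQ q n) (g ∘ₚ f) X

-- Write f₁ = T + q^r G₁ and f₂ = T + q^s G₂ modulo q^n. Then
-- f₁ ∘ f₂ = f₂ + q^r G₁(T + q^s G₂), and G₁(T + q^s G₂) ≡ G₁ modulo q^s, so
-- f₁ ∘ f₂ ≡ T + q^s G₂ + q^r G₁ modulo q^(r+s), hence modulo q^n. The right-hand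
-- side is symmetric in the two polynomials, so f₂ ∘ f₁ is congruent to it as well.
module Submission where

open import Defs
open import Level using (_⊔_)
open import Algebra.Bundles using (CommutativeRing)
import Algebra.Definitions as AlgebraDefinitions
import Data.Nat as Nat
open Nat using (ℕ; zero; suc; _≤_; _<_; s≤s)
open import Data.Nat.Properties using (≤-<-connex; m⊔n≤o⇒m≤o; m⊔n≤o⇒n≤o; m≤n⇒∃[o]m+o≡n)
open import Data.List using ([]; _∷_; length; applyUpTo)
open import Data.Product using (∃-syntax; _,_; proj₁; proj₂)
open import Data.Sum using (inj₁; inj₂)
open import Function using (_∘_)
open import Relation.Binary.Core using (Rel; _⇒_)
open import Relation.Binary.Bundles using (Setoid)
open import Relation.Binary.Structures using (IsEquivalence)
open import Relation.Binary.PropositionalEquality as ≡ using (_≡_)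
import Relation.Binary.Reasoning.Setoid as SetoidReasoning

module Coefficients {c ℓ} (R : CommutativeRing c ℓ) where
  open CommutativeRing R
  open Poly R
  open import Algebra.Properties.CommutativeSemigroup +-commutativeSemigroup
    using (interchange; xy∙z≈xz∙y)
  open SetoidReasoning setoid

  infix 4 _≐_
  record _≐_ (f g : Pol) : Set ℓ where
    constructor pointwise
    field coeff-≈ : ∀ i → coeff f i ≈ coeff g i
  open _≐_ public

  coeff-⊕ : ∀ f g i → coeff (f ⊕ g) i ≈ coeff f i + coeff g i
  coeff-⊕ []      g       i       = sym (+-identityˡ _)
  coeff-⊕ (a ∷ f) []      i       = sym (+-identityʳ _)
  coeff-⊕ (a ∷ f) (b ∷ g) zero    = refl
  coeff-⊕ (a ∷ f) (b ∷ g) (suc i) = coeff-⊕ f g i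

  coeff-scale : ∀ a f i → coeff (scale a f) i ≈ a * coeff f i
  coeff-scale a []      i       = sym (zeroʳ a)
  coeff-scale a (b ∷ f) zero    = refl
  coeff-scale a (b ∷ f) (suc i) = coeff-scale a f i

  coeff-⊕-scale : ∀ f a g i → coeff (f ⊕ scale a g) i ≈ coeff f i + a * coeff g i
  coeff-⊕-scale f a g i = trans (coeff-⊕ f (scale a g) i) (+-cong refl (coeff-scale a g i))

  coeff-≥-length : ∀ f {i} → length f ≤ i → coeff f i ≡ 0#
  coeff-≥-length []      _           = ≡.refl
  coeff-≥-length (a ∷ f) (s≤s len≤i) = coeff-≥-length f len≤i

  coeff-applyUpTo-< : ∀ e {L i} → i < L → coeff (applyUpTo e L) i ≡ e i
  coeff-applyUpTo-< e {suc L} {zero}  _         = ≡.refl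
  coeff-applyUpTo-< e {suc L} {suc i} (s≤s i<L) = coeff-applyUpTo-< (e ∘ suc) i<L

  coeff-applyUpTo-≥ : ∀ e {L i} → L ≤ i → coeff (applyUpTo e L) i ≡ 0#
  coeff-applyUpTo-≥ e {zero}          _         = ≡.refl
  coeff-applyUpTo-≥ e {suc L} {suc i} (s≤s L≤i) = coeff-applyUpTo-≥ (e ∘ suc) L≤i

  [0]≐[] : 0# ∷ [] ≐ []
  [0]≐[] = pointwise λ { zero → refl ; (suc i) → refl }

  ⊕-identityʳ : ∀ f → f ⊕ [] ≐ f
  ⊕-identityʳ f = pointwise λ i → trans (coeff-⊕ f [] i) (+-identityʳ _)

  ⊕-interchange : ∀ f g h k → (f ⊕ g) ⊕ (h ⊕ k) ≐ (f ⊕ h) ⊕ (g ⊕ k)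
  ⊕-interchange f g h k = pointwise λ i → begin
    coeff ((f ⊕ g) ⊕ (h ⊕ k)) i
      ≈⟨ trans (coeff-⊕ (f ⊕ g) (h ⊕ k) i) (+-cong (coeff-⊕ f g i) (coeff-⊕ h k i)) ⟩
    (coeff f i + coeff g i) + (coeff h i + coeff k i)
      ≈⟨ interchange _ _ _ _ ⟩
    (coeff f i + coeff h i) + (coeff g i + coeff k i)
      ≈⟨ trans (coeff-⊕ (f ⊕ h) (g ⊕ k) i) (+-cong (coeff-⊕ f h i) (coeff-⊕ g k i)) ⟨
    coeff ((f ⊕ h) ⊕ (g ⊕ k)) i ∎

  ⊕-swapʳ : ∀ f g h → (f ⊕ g) ⊕ h ≐ (f ⊕ h) ⊕ g
  ⊕-swapʳ f g h = pointwise λ i → begin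
    coeff ((f ⊕ g) ⊕ h) i
      ≈⟨ trans (coeff-⊕ (f ⊕ g) h i) (+-cong (coeff-⊕ f g i) refl) ⟩
    (coeff f i + coeff g i) + coeff h i
      ≈⟨ xy∙z≈xz∙y _ _ _ ⟩
    (coeff f i + coeff h i) + coeff g i
      ≈⟨ trans (coeff-⊕ (f ⊕ h) g i) (+-cong (coeff-⊕ f h i) refl) ⟨
    coeff ((f ⊕ h) ⊕ g) i ∎

  scale-distrib-⊕ : ∀ a f g → scale a (f ⊕ g) ≐ scale a f ⊕ scale a g
  scale-distrib-⊕ a f g = pointwise λ i → begin
    coeff (scale a (f ⊕ g)) i             ≈⟨ coeff-scale a (f ⊕ g) i ⟩
    a * coeff (f ⊕ g) i                   ≈⟨ *-cong refl (coeff-⊕ f g i) ⟩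
    a * (coeff f i + coeff g i)           ≈⟨ distribˡ a _ _ ⟩
    a * coeff f i + a * coeff g i         ≈⟨ +-cong (coeff-scale a f i) (coeff-scale a g i) ⟨
    coeff (scale a f) i + coeff (scale a g) i ≈⟨ coeff-⊕ (scale a f) (scale a g) i ⟨
    coeff (scale a f ⊕ scale a g) i       ∎

  scale-comm : ∀ a b f → scale a (scale b f) ≐ scale b (scale a f)
  scale-comm a b f = pointwise λ i → begin
    coeff (scale a (scale b f)) i
      ≈⟨ trans (coeff-scale a (scale b f) i) (*-cong refl (coeff-scale b f i)) ⟩
    a * (b * coeff f i)           ≈⟨ sym (*-assoc a b _) ⟩
    (a * b) * coeff f i           ≈⟨ *-cong (*-comm a b) refl ⟩
    (b * a) * coeff f i           ≈⟨ *-assoc b a _ ⟩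
    b * (a * coeff f i)
      ≈⟨ trans (coeff-scale b (scale a f) i) (*-cong refl (coeff-scale a f i)) ⟨
    coeff (scale b (scale a f)) i ∎

  scale-zero : ∀ f → scale 0# f ≐ []
  scale-zero f = pointwise λ i → trans (coeff-scale 0# f i) (zeroˡ _)

  scale-identity : ∀ f → scale 1# f ≐ f
  scale-identity f = pointwise λ i → trans (coeff-scale 1# f i) (*-identityˡ _)

-- A congruence of R in this sense is the same as an ideal I, via x ∼ y ⇔ x - y ∈ I.
record IsRingCongruence {c ℓ ℓ′} (R : CommutativeRing c ℓ)
                        (_∼_ : Rel (CommutativeRing.Carrier R) ℓ′) : Set (c ⊔ ℓ ⊔ ℓ′) where
  open CommutativeRing R using (_≈_; _+_; _*_)
  open AlgebraDefinitions _∼_ using (Congruent₂)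
  field
    isEquivalence : IsEquivalence _∼_
    reflexive     : _≈_ ⇒ _∼_
    +-cong        : Congruent₂ _+_
    *-cong        : Congruent₂ _*_

  open IsEquivalence isEquivalence public using (refl; sym; trans)

module PolyCongruence {c ℓ ℓ′} (R : CommutativeRing c ℓ)
                      {_∼_ : Rel (CommutativeRing.Carrier R) ℓ′}
                      (isCongruence : IsRingCongruence R _∼_) where
  open CommutativeRing R using (Carrier; _≈_; _+_; _*_; 0#; 1#)
  module R = CommutativeRing R
  module ∼ = IsRingCongruence isCongruence
  open Poly R
  open Coefficients R

  infix 4 _≋_
  record _≋_ (f g : Pol) : Set ℓ′ where
    constructor coeffwise
    field at : ∀ i → coeff f i ∼ coeff g i
  open _≋_ public

  ≋-refl : ∀ {f} → f ≋ f
  ≋-refl = coeffwise λ i → ∼.refl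

  ≋-sym : ∀ {f g} → f ≋ g → g ≋ f
  ≋-sym f≋g = coeffwise λ i → ∼.sym (at f≋g i)

  ≋-trans : ∀ {f g h} → f ≋ g → g ≋ h → f ≋ h
  ≋-trans f≋g g≋h = coeffwise λ i → ∼.trans (at f≋g i) (at g≋h i)

  ≋-setoid : Setoid c ℓ′
  ≋-setoid = record
    { Carrier       = Pol
    ; _≈_           = _≋_
    ; isEquivalence = record { refl = ≋-refl ; sym = ≋-sym ; trans = ≋-trans }
    }

  open SetoidReasoning ≋-setoid

  ∼-resp-≈ : ∀ {x x′ y y′} → x ≈ x′ → y ≈ y′ → x′ ∼ y′ → x ∼ y
  ∼-resp-≈ x≈x′ y≈y′ x′∼y′ = ∼.trans (∼.reflexive x≈x′) (∼.trans x′∼y′ (∼.reflexive (R.sym y≈y′)))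

  ≐⇒≋ : ∀ {f g} → f ≐ g → f ≋ g
  ≐⇒≋ f≐g = coeffwise λ i → ∼.reflexive (coeff-≈ f≐g i)

  tail-≋ : ∀ {a b f g} → a ∷ f ≋ b ∷ g → f ≋ g
  tail-≋ a∷f≋b∷g = coeffwise (at a∷f≋b∷g ∘ suc)

  tail-≋[] : ∀ {a f} → a ∷ f ≋ [] → f ≋ []
  tail-≋[] a∷f≋[] = coeffwise (at a∷f≋[] ∘ suc)

  ∷-cong : ∀ {a b f g} → a ∼ b → f ≋ g → a ∷ f ≋ b ∷ g
  ∷-cong a∼b f≋g = coeffwise λ { zero → a∼b ; (suc i) → at f≋g i }

  ⊕-cong : ∀ {f f′ g g′} → f ≋ f′ → g ≋ g′ → f ⊕ g ≋ f′ ⊕ g′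
  ⊕-cong {f} {f′} {g} {g′} f≋f′ g≋g′ = coeffwise λ i →
    ∼-resp-≈ (coeff-⊕ f g i) (coeff-⊕ f′ g′ i) (∼.+-cong (at f≋f′ i) (at g≋g′ i))

  ⊕-congˡ : ∀ f {g g′} → g ≋ g′ → f ⊕ g ≋ f ⊕ g′
  ⊕-congˡ f = ⊕-cong ≋-refl

  scale-cong : ∀ {a b f g} → a ∼ b → f ≋ g → scale a f ≋ scale b g
  scale-cong {a} {b} {f} {g} a∼b f≋g = coeffwise λ i →
    ∼-resp-≈ (coeff-scale a f i) (coeff-scale b g i) (∼.*-cong a∼b (at f≋g i))

  [0]≋[] : 0# ∷ [] ≋ []
  [0]≋[] = ≐⇒≋ [0]≐[]

  ⊗-zeroʳ : ∀ f → f ⊗ [] ≋ []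
  ⊗-zeroʳ []      = ≋-refl
  ⊗-zeroʳ (a ∷ f) = ≋-trans (∷-cong ∼.refl (⊗-zeroʳ f)) [0]≋[]

  -- Lists are not normalised: a nonempty list can be ≋ [], so the congruence proofs
  -- below treat the mixed cases through these two lemmas.
  ⊗-zeroˡ : ∀ f g → f ≋ [] → f ⊗ g ≋ []
  ⊗-zeroˡ []      g f≋[] = ≋-refl
  ⊗-zeroˡ (a ∷ f) g f≋[] = begin
    scale a g ⊕ (0# ∷ f ⊗ g)
      ≈⟨ ⊕-cong (scale-cong (at f≋[] 0) ≋-refl) (∷-cong ∼.refl (⊗-zeroˡ f g (tail-≋[] f≋[]))) ⟩
    scale 0# g ⊕ (0# ∷ [])
      ≈⟨ ⊕-cong (≐⇒≋ (scale-zero g)) [0]≋[] ⟩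
    [] ∎

  ⊗-congˡ : ∀ f f′ g → f ≋ f′ → f ⊗ g ≋ f′ ⊗ g
  ⊗-congˡ []      f′       g f≋f′ = ≋-sym (⊗-zeroˡ f′ g (≋-sym f≋f′))
  ⊗-congˡ (a ∷ f) []       g f≋f′ = ⊗-zeroˡ (a ∷ f) g f≋f′
  ⊗-congˡ (a ∷ f) (a′ ∷ f′) g f≋f′ =
    ⊕-cong (scale-cong (at f≋f′ 0) ≋-refl) (∷-cong ∼.refl (⊗-congˡ f f′ g (tail-≋ f≋f′)))

  ⊗-congʳ : ∀ f {g g′} → g ≋ g′ → f ⊗ g ≋ f ⊗ g′
  ⊗-congʳ []      g≋g′ = ≋-refl
  ⊗-congʳ (a ∷ f) g≋g′ = ⊕-cong (scale-cong ∼.refl g≋g′) (∷-cong ∼.refl (⊗-congʳ f g≋g′))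

  ⊗-cong : ∀ {f f′ g g′} → f ≋ f′ → g ≋ g′ → f ⊗ g ≋ f′ ⊗ g′
  ⊗-cong {f} {f′} {g} f≋f′ g≋g′ = ≋-trans (⊗-congˡ f f′ g f≋f′) (⊗-congʳ f′ g≋g′)

  ∘ₚ-zeroˡ : ∀ f g → f ≋ [] → f ∘ₚ g ≋ []
  ∘ₚ-zeroˡ []      g f≋[] = ≋-refl
  ∘ₚ-zeroˡ (a ∷ f) g f≋[] = begin
    (a ∷ []) ⊕ g ⊗ (f ∘ₚ g)
      ≈⟨ ⊕-cong (∷-cong (at f≋[] 0) ≋-refl) (⊗-congʳ g (∘ₚ-zeroˡ f g (tail-≋[] f≋[]))) ⟩
    (0# ∷ []) ⊕ g ⊗ []
      ≈⟨ ⊕-cong [0]≋[] (⊗-zeroʳ g) ⟩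
    [] ∎

  ∘ₚ-congˡ : ∀ f f′ g → f ≋ f′ → f ∘ₚ g ≋ f′ ∘ₚ g
  ∘ₚ-congˡ []      f′       g f≋f′ = ≋-sym (∘ₚ-zeroˡ f′ g (≋-sym f≋f′))
  ∘ₚ-congˡ (a ∷ f) []       g f≋f′ = ∘ₚ-zeroˡ (a ∷ f) g f≋f′
  ∘ₚ-congˡ (a ∷ f) (a′ ∷ f′) g f≋f′ =
    ⊕-cong (∷-cong (at f≋f′ 0) ≋-refl) (⊗-congʳ g (∘ₚ-congˡ f f′ g (tail-≋ f≋f′)))

  ∘ₚ-congʳ : ∀ f {g g′} → g ≋ g′ → f ∘ₚ g ≋ f ∘ₚ g′
  ∘ₚ-congʳ []      g≋g′ = ≋-refl
  ∘ₚ-congʳ (a ∷ f) g≋g′ = ⊕-congˡ (a ∷ []) (⊗-cong g≋g′ (∘ₚ-congʳ f g≋g′))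

  ∘ₚ-cong : ∀ {f f′ g g′} → f ≋ f′ → g ≋ g′ → f ∘ₚ g ≋ f′ ∘ₚ g′
  ∘ₚ-cong {f} {f′} {g} f≋f′ g≋g′ = ≋-trans (∘ₚ-congˡ f f′ g f≋f′) (∘ₚ-congʳ f′ g≋g′)

  ⊗-identityʳ : ∀ f → f ⊗ (1# ∷ []) ≋ f
  ⊗-identityʳ []      = ≋-refl
  ⊗-identityʳ (a ∷ f) =
    ∷-cong (∼.reflexive (R.trans (R.+-identityʳ _) (R.*-identityʳ a))) (⊗-identityʳ f)

  ⊗-distribˡ-⊕ : ∀ h f g → h ⊗ (f ⊕ g) ≋ h ⊗ f ⊕ h ⊗ g
  ⊗-distribˡ-⊕ []      f g = ≋-refl
  ⊗-distribˡ-⊕ (a ∷ h) f g = begin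
    scale a (f ⊕ g) ⊕ (0# ∷ h ⊗ (f ⊕ g))
      ≈⟨ ⊕-cong (≐⇒≋ (scale-distrib-⊕ a f g))
                (∷-cong (∼.reflexive (R.sym (R.+-identityʳ 0#))) (⊗-distribˡ-⊕ h f g)) ⟩
    (scale a f ⊕ scale a g) ⊕ ((0# ∷ h ⊗ f) ⊕ (0# ∷ h ⊗ g))
      ≈⟨ ≐⇒≋ (⊕-interchange (scale a f) (scale a g) (0# ∷ h ⊗ f) (0# ∷ h ⊗ g)) ⟩
    (scale a f ⊕ (0# ∷ h ⊗ f)) ⊕ (scale a g ⊕ (0# ∷ h ⊗ g)) ∎

  ⊗-scaleʳ : ∀ h a f → h ⊗ scale a f ≋ scale a (h ⊗ f)
  ⊗-scaleʳ []      a f = ≋-refl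
  ⊗-scaleʳ (b ∷ h) a f = begin
    scale b (scale a f) ⊕ (0# ∷ h ⊗ scale a f)
      ≈⟨ ⊕-cong (≐⇒≋ (scale-comm b a f)) (∷-cong (∼.reflexive (R.sym (R.zeroʳ a))) (⊗-scaleʳ h a f)) ⟩
    scale a (scale b f) ⊕ scale a (0# ∷ h ⊗ f)
      ≈⟨ ≐⇒≋ (scale-distrib-⊕ a (scale b f) (0# ∷ h ⊗ f)) ⟨
    scale a (scale b f ⊕ (0# ∷ h ⊗ f)) ∎

  X-⊗ : ∀ f → X ⊗ f ≋ 0# ∷ f
  X-⊗ f = ≋-trans
    (⊕-cong (≐⇒≋ (scale-zero f)) (∷-cong ∼.refl (⊕-cong (≐⇒≋ (scale-identity f)) [0]≋[])))
    (∷-cong ∼.refl (≐⇒≋ (⊕-identityʳ f)))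

  ∘ₚ-identityˡ : ∀ f → X ∘ₚ f ≋ f
  ∘ₚ-identityˡ f = begin
    (0# ∷ []) ⊕ f ⊗ ((1# ∷ []) ⊕ f ⊗ [])
      ≈⟨ ⊕-cong [0]≋[] (⊗-congʳ f (⊕-congˡ (1# ∷ []) (⊗-zeroʳ f))) ⟩
    f ⊗ ((1# ∷ []) ⊕ [])
      ≈⟨ ⊗-identityʳ f ⟩
    f ∎

  ∘ₚ-identityʳ : ∀ f → f ∘ₚ X ≋ f
  ∘ₚ-identityʳ []      = ≋-refl
  ∘ₚ-identityʳ (a ∷ f) = begin
    (a ∷ []) ⊕ X ⊗ (f ∘ₚ X)
      ≈⟨ ⊕-congˡ (a ∷ []) (≋-trans (X-⊗ (f ∘ₚ X)) (∷-cong ∼.refl (∘ₚ-identityʳ f))) ⟩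
    (a ∷ []) ⊕ (0# ∷ f)
      ≈⟨ ∷-cong (∼.reflexive (R.+-identityʳ a)) ≋-refl ⟩
    a ∷ f ∎

  ∘ₚ-distribʳ-⊕ : ∀ f g h → (f ⊕ g) ∘ₚ h ≋ f ∘ₚ h ⊕ g ∘ₚ h
  ∘ₚ-distribʳ-⊕ []      g       h = ≋-refl
  ∘ₚ-distribʳ-⊕ (a ∷ f) []      h = ≋-sym (≐⇒≋ (⊕-identityʳ ((a ∷ f) ∘ₚ h)))
  ∘ₚ-distribʳ-⊕ (a ∷ f) (b ∷ g) h = begin
    ((a ∷ []) ⊕ (b ∷ [])) ⊕ h ⊗ ((f ⊕ g) ∘ₚ h)
      ≈⟨ ⊕-congˡ ((a ∷ []) ⊕ (b ∷ []))
           (≋-trans (⊗-congʳ h (∘ₚ-distribʳ-⊕ f g h)) (⊗-distribˡ-⊕ h (f ∘ₚ h) (g ∘ₚ h))) ⟩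
    ((a ∷ []) ⊕ (b ∷ [])) ⊕ (h ⊗ (f ∘ₚ h) ⊕ h ⊗ (g ∘ₚ h))
      ≈⟨ ≐⇒≋ (⊕-interchange (a ∷ []) (b ∷ []) (h ⊗ (f ∘ₚ h)) (h ⊗ (g ∘ₚ h))) ⟩
    ((a ∷ []) ⊕ h ⊗ (f ∘ₚ h)) ⊕ ((b ∷ []) ⊕ h ⊗ (g ∘ₚ h)) ∎

  scale-∘ₚ : ∀ a f h → scale a f ∘ₚ h ≋ scale a (f ∘ₚ h)
  scale-∘ₚ a []      h = ≋-refl
  scale-∘ₚ a (b ∷ f) h = begin
    ((a * b) ∷ []) ⊕ h ⊗ (scale a f ∘ₚ h)
      ≈⟨ ⊕-congˡ ((a * b) ∷ []) (≋-trans (⊗-congʳ h (scale-∘ₚ a f h)) (⊗-scaleʳ h a (f ∘ₚ h))) ⟩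
    scale a (b ∷ []) ⊕ scale a (h ⊗ (f ∘ₚ h))
      ≈⟨ ≐⇒≋ (scale-distrib-⊕ a (b ∷ []) (h ⊗ (f ∘ₚ h))) ⟨
    scale a ((b ∷ []) ⊕ h ⊗ (f ∘ₚ h)) ∎

  ∃⊕-scale : ∀ a f g → (∀ i → ∃[ e ] coeff f i ∼ (coeff g i + a * e)) → ∃[ G ] f ≋ g ⊕ scale a G
  ∃⊕-scale a f g witness = G , f≋g⊕aG
    where
    e : ℕ → Carrier
    e i = proj₁ (witness i)

    L : ℕ
    L = length f Nat.⊔ length g

    G : Pol
    G = applyUpTo e L

    coeff-f∼ : ∀ i → coeff f i ∼ (coeff g i + a * coeff G i)
    coeff-f∼ i with ≤-<-connex L i
    ... | inj₂ i<L rewrite coeff-applyUpTo-< e i<L = proj₂ (witness i)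
    ... | inj₁ L≤i rewrite coeff-≥-length f (m⊔n≤o⇒m≤o _ _ L≤i)
                         | coeff-≥-length g (m⊔n≤o⇒n≤o _ _ L≤i)
                         | coeff-applyUpTo-≥ e L≤i =
      ∼.reflexive (R.sym (R.trans (R.+-identityˡ _) (R.zeroʳ a)))

    f≋g⊕aG : f ≋ g ⊕ scale a G
    f≋g⊕aG = coeffwise λ i → ∼-resp-≈ R.refl (coeff-⊕-scale g a G i) (coeff-f∼ i)

module Modulo {c ℓ} (R : CommutativeRing c ℓ) where
  open CommutativeRing R
  open Poly R using (pow; ModQIn)
  open import Algebra.Properties.Semiring.Divisibility semiring
    using (_∣_; _∣0; ∣ʳ-respʳ-≈; ∣ʳ-trans; x∣ʳy⇒x∣ʳzy)
  open import Algebra.Definitions.RawMagma *-rawMagma using (_,_)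
  open import Algebra.Properties.CommutativeSemigroup.Divisibility *-commutativeSemigroup
    using (x∣xy; x∣y⇒zx∣zy)
  open import Algebra.Properties.AbelianGroup +-abelianGroup using (⁻¹-anti-homo‿-; ⁻¹-∙-comm; xyx⁻¹≈y)
  open import Algebra.Properties.Ring ring using (-1*x≈-x; x[y-z]≈xy-xz)
  open import Algebra.Properties.CommutativeSemigroup +-commutativeSemigroup using (interchange)
  open SetoidReasoning setoid

  infix 4 _≈_[mod_]
  _≈_[mod_] : Carrier → Carrier → Carrier → Set (c ⊔ ℓ)
  x ≈ y [mod m ] = m ∣ x - y

  ∣-+ : ∀ {m x y} → m ∣ x → m ∣ y → m ∣ x + y
  ∣-+ {m} (p , pm≈x) (p′ , p′m≈y) = p + p′ , trans (distribʳ m p p′) (+-cong pm≈x p′m≈y)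

  ∣-neg : ∀ {m x} → m ∣ x → m ∣ - x
  ∣-neg {x = x} m∣x = ∣ʳ-respʳ-≈ (-1*x≈-x x) (x∣ʳy⇒x∣ʳzy (- 1#) m∣x)

  [x-y]+[y-z]≈x-z : ∀ x y z → (x - y) + (y - z) ≈ x - z
  [x-y]+[y-z]≈x-z x y z = begin
    (x - y) + (y - z)   ≈⟨ +-assoc x (- y) (y - z) ⟩
    x + (- y + (y - z)) ≈⟨ +-cong refl (sym (+-assoc (- y) y (- z))) ⟩
    x + ((- y + y) - z) ≈⟨ +-cong refl (+-cong (-‿inverseˡ y) refl) ⟩
    x + (0# - z)        ≈⟨ +-cong refl (+-identityˡ (- z)) ⟩
    x - z               ∎

  [x+u]-[y+v]≈[x-y]+[u-v] : ∀ x y u v → (x + u) - (y + v) ≈ (x - y) + (u - v)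
  [x+u]-[y+v]≈[x-y]+[u-v] x y u v =
    trans (+-cong refl (sym (⁻¹-∙-comm y v))) (interchange x u (- y) (- v))

  mod-isRingCongruence : ∀ m → IsRingCongruence R (λ x y → x ≈ y [mod m ])
  mod-isRingCongruence m = record
    { isEquivalence = record { refl = ≈⇒≈[mod] refl ; sym = ≈[mod]-sym ; trans = ≈[mod]-trans }
    ; reflexive     = ≈⇒≈[mod]
    ; +-cong        = λ x∼y u∼v → ∣ʳ-respʳ-≈ (sym ([x+u]-[y+v]≈[x-y]+[u-v] _ _ _ _)) (∣-+ x∼y u∼v)
    ; *-cong        = ≈[mod]-*-cong
    }
    where
    ≈⇒≈[mod] : ∀ {x y} → x ≈ y → x ≈ y [mod m ]
    ≈⇒≈[mod] {x} {y} x≈y = ∣ʳ-respʳ-≈ (sym (trans (+-cong x≈y refl) (-‿inverseʳ y))) (m ∣0)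

    ≈[mod]-sym : ∀ {x y} → x ≈ y [mod m ] → y ≈ x [mod m ]
    ≈[mod]-sym {x} {y} x∼y = ∣ʳ-respʳ-≈ (⁻¹-anti-homo‿- x y) (∣-neg x∼y)

    ≈[mod]-trans : ∀ {x y z} → x ≈ y [mod m ] → y ≈ z [mod m ] → x ≈ z [mod m ]
    ≈[mod]-trans {x} {y} {z} x∼y y∼z = ∣ʳ-respʳ-≈ ([x-y]+[y-z]≈x-z x y z) (∣-+ x∼y y∼z)

    ≈[mod]-*-congˡ : ∀ z {x y} → x ≈ y [mod m ] → z * x ≈ z * y [mod m ]
    ≈[mod]-*-congˡ z {x} {y} x∼y = ∣ʳ-respʳ-≈ (x[y-z]≈xy-xz z x y) (x∣ʳy⇒x∣ʳzy z x∼y)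

    ≈[mod]-*-cong : ∀ {x y u v} → x ≈ y [mod m ] → u ≈ v [mod m ] → x * u ≈ y * v [mod m ]
    ≈[mod]-*-cong {x} {y} {u} {v} x∼y u∼v = ≈[mod]-trans (≈[mod]-*-congˡ x u∼v)
      (∣ʳ-respʳ-≈ (+-cong (*-comm v x) (-‿cong (*-comm v y))) (≈[mod]-*-congˡ v x∼y))

  x+my≈x : ∀ m x y → x + m * y ≈ x [mod m ]
  x+my≈x m x y = ∣ʳ-respʳ-≈ (sym (xyx⁻¹≈y x (m * y))) (x∣xy m y)

  *-cong-mod : ∀ {m a b x y} → m ∣ a * b → x ≈ y [mod b ] → a * x ≈ a * y [mod m ]
  *-cong-mod {a = a} {x = x} {y} m∣ab b∣x-y =
    ∣ʳ-respʳ-≈ (x[y-z]≈xy-xz a x y) (∣ʳ-trans m∣ab (x∣y⇒zx∣zy a b∣x-y))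

  ModQIn⇒≈[mod] : ∀ q n r {x y} → ModQIn q n r x y → ∃[ e ] x ≈ y + pow q r * e [mod pow q n ]
  ModQIn⇒≈[mod] q n r {x} {y} (e , d , x-y≈) = e , ∣ʳ-respʳ-≈ (sym (begin
    x - (y + pow q r * e)                     ≈⟨ +-cong refl (sym (⁻¹-∙-comm y _)) ⟩
    x + (- y - pow q r * e)                   ≈⟨ sym (+-assoc x (- y) _) ⟩
    (x - y) - pow q r * e                     ≈⟨ +-cong x-y≈ refl ⟩
    (pow q r * e + pow q n * d) - pow q r * e ≈⟨ xyx⁻¹≈y _ _ ⟩
    pow q n * d                               ∎)) (x∣xy (pow q n) d)

  pow-+ : ∀ x m k → pow x (m Nat.+ k) ≈ pow x m * pow x k
  pow-+ x zero    k = sym (*-identityˡ _)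
  pow-+ x (suc m) k = trans (*-cong refl (pow-+ x m k)) (sym (*-assoc x _ _))

  pow∣pow*pow : ∀ x {n} r s → n ≤ r Nat.+ s → pow x n ∣ pow x r * pow x s
  pow∣pow*pow x {n} r s n≤r+s = let (k , n+k≡r+s) = m≤n⇒∃[o]m+o≡n n≤r+s in
    ∣ʳ-respʳ-≈ (begin
      pow x n * pow x k ≈⟨ pow-+ x n k ⟨
      pow x (n Nat.+ k) ≡⟨ ≡.cong (pow x) n+k≡r+s ⟩
      pow x (r Nat.+ s) ≈⟨ pow-+ x r s ⟩
      pow x r * pow x s ∎) (x∣xy (pow x n) (pow x k))

module PolyModulo {c ℓ} (R : CommutativeRing c ℓ) where
  open CommutativeRing R
  open Poly R
  open Coefficients R using (coeff-scale; coeff-⊕-scale; ⊕-swapʳ)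
  open Modulo R
  open import Algebra.Properties.Semiring.Divisibility semiring using (_∣_; ∣ʳ-respʳ-≈)
  open import Algebra.Definitions.RawMagma *-rawMagma using (_,_)

  module Mod (m : Carrier) = PolyCongruence R (mod-isRingCongruence m)

  infix 4 _≋_[mod_]
  _≋_[mod_] : Pol → Pol → Carrier → Set (c ⊔ ℓ)
  f ≋ g [mod m ] = Mod._≋_ m f g

  f⊕mg≋f : ∀ m f g → f ⊕ scale m g ≋ f [mod m ]
  f⊕mg≋f m f g = Mod.coeffwise λ i →
    Mod.∼-resp-≈ m (coeff-⊕-scale f m g i) refl (x+my≈x m (coeff f i) (coeff g i))

  scale-cong-mod : ∀ {m a b f g} → m ∣ a * b → f ≋ g [mod b ] → scale a f ≋ scale a g [mod m ]
  scale-cong-mod {m} {a} {b} {f} {g} m∣ab f≋g = Mod.coeffwise λ i →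
    Mod.∼-resp-≈ m (coeff-scale a f i) (coeff-scale a g i) (*-cong-mod m∣ab (Mod.at f≋g i))

  -- Since G ∘ (T + b H) ≡ G modulo b, the factor a turns this into a congruence modulo a b.
  near-identity-∘ₚ : ∀ {m a b} G H → m ∣ a * b →
    (X ⊕ scale a G) ∘ₚ (X ⊕ scale b H) ≋ (X ⊕ scale b H) ⊕ scale a G [mod m ]
  near-identity-∘ₚ {m} {a} {b} G H m∣ab = begin
    (X ⊕ scale a G) ∘ₚ P    ≈⟨ ∘ₚ-distribʳ-⊕ X (scale a G) P ⟩
    X ∘ₚ P ⊕ scale a G ∘ₚ P ≈⟨ ⊕-cong (∘ₚ-identityˡ P) (scale-∘ₚ a G P) ⟩
    P ⊕ scale a (G ∘ₚ P)    ≈⟨ ⊕-congˡ P (scale-cong-mod m∣ab G∘P≋G) ⟩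
    P ⊕ scale a G           ∎
    where
    open Mod m
    open SetoidReasoning ≋-setoid

    P : Pol
    P = X ⊕ scale b H

    G∘P≋G : G ∘ₚ P ≋ G [mod b ]
    G∘P≋G = Mod.≋-trans b (Mod.∘ₚ-congʳ b G (f⊕mg≋f b X H)) (Mod.∘ₚ-identityʳ b G)

  near-identity-commute : ∀ {m a b} G H → m ∣ a * b →
    (X ⊕ scale a G) ∘ₚ (X ⊕ scale b H) ≋ (X ⊕ scale b H) ∘ₚ (X ⊕ scale a G) [mod m ]
  near-identity-commute {m} {a} {b} G H m∣ab =
    Mod.≋-trans m (near-identity-∘ₚ G H m∣ab)
      (Mod.≋-trans m (Mod.≐⇒≋ m (⊕-swapʳ X (scale b H) (scale a G)))
        (Mod.≋-sym m (near-identity-∘ₚ H G (∣ʳ-respʳ-≈ (*-comm a b) m∣ab))))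

  ≋[mod]⇒ModQ : ∀ q n {f g} → f ≋ g [mod pow q n ] → PolyRel (ModQ q n) f g
  ≋[mod]⇒ModQ q n f≋g i = let (d , d*qⁿ≈) = Mod.at f≋g i in d , trans (sym d*qⁿ≈) (*-comm d _)

open Nat using (_+_)

lemma4p4 : ∀ {c ℓ} (R : CommutativeRing c ℓ) →
    let open Poly R in
    (q : CommutativeRing.Carrier R) → TorsionFree q →
    (n : ℕ) → 1 ≤ n →
    (f₁ f₂ : Pol) → IsAut q n f₁ → IsAut q n f₂ →
    (r s : ℕ) → n ≤ r + s →
    PolyRel (ModQIn q n r) f₁ X → PolyRel (ModQIn q n s) f₂ X →
    PolyRel (ModQ q n) (f₁ ∘ₚ f₂) (f₂ ∘ₚ f₁)
lemma4p4 R q _ n _ f₁ f₂ _ _ r s n≤r+s f₁≡X f₂≡X = ≋[mod]⇒ModQ q n (begin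
    f₁ ∘ₚ f₂ ≈⟨ ∘ₚ-cong f₁≋P₁ f₂≋P₂ ⟩
    P₁ ∘ₚ P₂ ≈⟨ near-identity-commute G₁ G₂ (pow∣pow*pow q r s n≤r+s) ⟩
    P₂ ∘ₚ P₁ ≈⟨ ∘ₚ-cong f₂≋P₂ f₁≋P₁ ⟨
    f₂ ∘ₚ f₁ ∎)
  where
  open Poly R
  open Modulo R
  open PolyModulo R
  open Mod (pow q n)
  open SetoidReasoning ≋-setoid

  near-identity-form : ∀ t f → PolyRel (ModQIn q n t) f X → ∃[ G ] f ≋ X ⊕ scale (pow q t) G
  near-identity-form t f f≡X = ∃⊕-scale (pow q t) f X (λ i → ModQIn⇒≈[mod] q n t (f≡X i))

  G₁ G₂ P₁ P₂ : Pol
  G₁ = proj₁ (near-identity-form r f₁ f₁≡X)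
  G₂ = proj₁ (near-identity-form s f₂ f₂≡X)
  P₁ = X ⊕ scale (pow q r) G₁
  P₂ = X ⊕ scale (pow q s) G₂

  f₁≋P₁ : f₁ ≋ P₁
  f₁≋P₁ = proj₂ (near-identity-form r f₁ f₁≡X)

  f₂≋P₂ : f₂ ≋ P₂
  f₂≋P₂ = proj₂ (near-identity-form s f₂ f₂≡X)
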